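{- Let $s$ be a string with Lyndon runs $F_1,\dots,F_m$. Let $\mathrm{dom}_{d+p-1}(F_i),\dots,\mathrm{dom}_d(F_{i+p-1})$ be a $p$-group and $\mathrm{dom}_{d'+p'-1}(F_k),\dots,\mathrm{dom}_{d'}(F_{k+p'-1})$ a $p'$-group, with $p,p'\ge2$, which are disjoint, i.e. $i+p-1<k$ or $k+p'-1<i$. Then the substrings of $s$ associated with these two groups do not overlap.
   Context: Let $s=f_1^{e_1}\cdots f_m^{e_m}$ be the Lyndon factorization of $s$ (each $f_i$ a Lyndon word, i.e. a nonempty string strictly lexicographically smaller than all its nonempty proper suffixes; $e_i\ge1$; $f_i\succ f_{i+1}$) and $F_i=f_i^{e_i}$ the Lyndon runs, viewed as consecutive substrings of $s$. For $d\ge1$, $1\le i\le m-d+1$, the leftmost occurrence of $F_i\cdots F_{i+d-1}$ in $s$ begins at the first position of some run $F_j$, $j\le i$; $\mathrm{dom}_d(F_i)=F_j\cdots F_{i-1}$ (empty if $j=i$) and $\mathrm{extdom}_d(F_i)=F_j\cdots F_{i+d-1}$, as substrings (positions) of $s$. For $d\ge1$, $p\ge2$, $1\le i\le m-d-p+2$, the domains $\mathrm{dom}_{d+p-1}(F_i),\dots,\mathrm{dom}_d(F_{i+p-1})$ form a $p$-group if $\mathrm{extdom}_{d+p-1}(F_i)=\mathrm{extdom}_{d+p-2}(F_{i+1})=\cdots=\mathrm{extdom}_d(F_{i+p-1})$ ($\mathrm{dom}_{d+p-1}(F_i)$ may be empty). Then $F_{i+p-1}\cdots F_{i+p+d-2}$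 is a prefix of $F_i$, so the leftmost occurrence of $F_i\cdots F_{i+p+d-2}$ in $s$ can be written as $F_{i+p-1}\cdots F_{i+p+d-2}\,x\,F_{i+1}\cdots F_{i+p+d-2}$; the occurrence of $xF_{i+1}\cdots F_{i+p+d-2}$ forming its suffix is the substring associated with the $p$-group. -}

module Defs where

open import Data.Nat using (ℕ; zero; suc; _+_; _∸_; _≤_) renaming (_<_ to _<ℕ_)
open import Data.Nat.ListAction using (sum)
open import Data.List using (List; []; _∷_; _++_; length; take; drop; concat; map; replicate)
open import Data.List.Relation.Unary.All using (All)
open import Data.List.Relation.Unary.Linked using (Linked)
open import Data.Product using (_×_; _,_; proj₁; proj₂; Σ; ∃)
open import Relation.Binary.PropositionalEquality using (_≡_; _≢_)

module L {A : Set} (_<_ : A → A → Set) where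

  data _≺_ : List A → List A → Set where
    []≺  : ∀ {y ys} → [] ≺ (y ∷ ys)
    here : ∀ {x y xs ys} → x < y → (x ∷ xs) ≺ (y ∷ ys)
    there : ∀ {x xs ys} → xs ≺ ys → (x ∷ xs) ≺ (x ∷ ys)

  Lyndon : List A → Set
  Lyndon w = (w ≢ []) × (∀ u v → u ≢ [] → v ≢ [] → w ≡ u ++ v → w ≺ v)

  -- a Lyndon run f^e is represented by the pair (f , e)
  Run : Set
  Run = List A × ℕ

  runStr : Run → List A
  runStr (f , e) = concat (replicate e f)

  IsLyndonFactorization : List A → List Run → Set
  IsLyndonFactorization s R =
    (concat (map runStr R) ≡ s)
    × All (λ r → Lyndon (proj₁ r)) R
    × All (λ r → 1 ≤ proj₂ r) R
    × Linked (λ r r' → proj₁ r' ≺ proj₁ r) R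

  -- total length of the first k runs; run F_i (1-based) occupies
  -- positions [pre R (i ∸ 1), pre R i) of s (0-based positions)
  pre : List Run → ℕ → ℕ
  pre R k = sum (map (λ r → length (runStr r)) (take k R))

  -- the string F_i F_{i+1} ⋯ F_{i+d-1} (1-based i)
  W : List Run → ℕ → ℕ → List A
  W R i d = concat (map runStr (take d (drop (i ∸ 1) R)))

  OccursAt : List A → List A → ℕ → Set
  OccursAt s w q = take (length w) (drop q s) ≡ w

  Leftmost : List A → List A → ℕ → Set
  Leftmost s w q = OccursAt s w q × (∀ q' → OccursAt s w q' → q ≤ q')

  -- half-open intervals of positions [a , b)
  Interval : Set
  Interval = ℕ × ℕ

  -- extdom_d(F_i) = I, as an interval of positions: from the start of the
  -- leftmost occurrence of F_i⋯F_{i+d-1} (the start of some run F_j)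
  -- to the end of F_{i+d-1}
  ExtDom : List A → List Run → ℕ → ℕ → Interval → Set
  ExtDom s R d i I = Leftmost s (W R i d) (proj₁ I) × (proj₂ I ≡ pre R (i + d ∸ 1))

  PGroup : List A → List Run → ℕ → ℕ → ℕ → Set
  PGroup s R d p i =
    (1 ≤ d) × (2 ≤ p) × (1 ≤ i) × (i + d + p ∸ 2 ≤ length R)
    × Σ Interval (λ I → ∀ t → t <ℕ p → ExtDom s R (d + p ∸ 1 ∸ t) (i + t) I)

  -- the substring associated with that p-group, as an interval of positions:
  -- the leftmost occurrence [q , q + |F_i⋯F_{i+p+d-2}|) of F_i⋯F_{i+p+d-2}
  -- is F_{i+p-1}⋯F_{i+p+d-2} x F_{i+1}⋯F_{i+p+d-2}; the associated substring
  -- is the suffix x F_{i+1}⋯F_{i+p+d-2}, i.e. it starts after the prefix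
  -- F_{i+p-1}⋯F_{i+p+d-2}.
  Assoc : List A → List Run → ℕ → ℕ → ℕ → Interval → Set
  Assoc s R d p i J =
    ∃ λ q → Leftmost s (W R i (d + p ∸ 1)) q
      × (proj₁ J ≡ q + length (W R (i + p ∸ 1) d))
      × (proj₂ J ≡ q + length (W R i (d + p ∸ 1)))

  Overlap : Interval → Interval → Set
  Overlap (a , b) (a' , b') = ∃ λ x → (a ≤ x × x <ℕ b) × (a' ≤ x × x <ℕ b')

-- The associated substring of a p-group is covered by pieces: for consecutive domains, F_{a+1}⋯F_{a+n}
-- and F_a⋯F_{a+n} have their leftmost occurrences at the same q, and the piece is [q + |F_{a+1}⋯F_{a+n}|,
-- q + |F_a⋯F_{a+n}|). With f the Lyndon root of F_a, s then reads f f f ⋯ on [q, q + |F_a⋯F_{a+n}|), the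
-- tail F_{a+1}⋯F_{a+n} is shorter than f (f is no prefix of a product of smaller Lyndon words), and q is
-- the start of a run (a leftmost occurrence of a Lyndon root can only start a run).
-- Pieces of disjoint groups come from runs a + 2 ≤ a′, so their roots satisfy f′ ≺ g ≺ f, g the root of
-- F_{a+1}. If they overlapped with q = q′, g would lie in the window read as f′ f′ ⋯ and, being Lyndon,
-- be a prefix of f′. Otherwise the piece starting later either has its tail a whole period inside the
-- other window, which moves its leftmost occurrence back by one period, or starts within the first copy
-- of the other root: for q < q′ this forces f′ ⊑ f by Lyndon minimality of f, for q′ < q the run starting
-- at q′ has a root that is a proper prefix of f′; both contradict the order of the roots.

module Submission where

open import Defs
open import Data.Nat using (ℕ; zero; suc; pred; _+_; _*_; _∸_; _<_; _≤_; z≤n; s≤s; _%_; _/_; NonZero; >-nonZero; >-nonZero⁻¹)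
open import Data.Nat.Properties
open import Data.Nat.DivMod
open import Data.Nat.Induction using (<-rec)
open import Data.List using (List; []; _∷_; _++_; length; take; drop; concat; map; replicate)
open import Data.List.Properties using (length-++; take++drop≡id; length-drop; concat-++; map-++; ++-assoc)
open import Data.List.Relation.Unary.All using (All; []; _∷_)
open import Data.List.Relation.Unary.All.Properties using (++⁺; replicate⁺; take⁺)
open import Data.List.Relation.Unary.AllPairs using (AllPairs; []; _∷_)
open import Data.List.Relation.Unary.Linked.Properties using (Linked⇒AllPairs)
open import Data.Maybe using (Maybe; just; nothing)
open import Data.Product using (_×_; _,_; proj₁; proj₂; ∃-syntax; ∃₂)
open import Data.Sum using (_⊎_; inj₁; inj₂; [_,_])
import Data.Sum as Sum
open import Data.Empty using (⊥; ⊥-elim)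
open import Function using (case_of_)
open import Relation.Nullary using (¬_; yes; no)
open import Relation.Binary.Definitions using (tri<; tri≈; tri>)
open import Relation.Binary.PropositionalEquality using (_≡_; _≢_; refl; sym; trans; cong; cong₂; subst; module ≡-Reasoning)
open import Relation.Binary.Structures using (IsStrictTotalOrder)

module Words {A : Set} where

  private
    variable
      x : A
      xs s t v w : List A
      a j q z L e : ℕ

  infixl 9 _!_
  _!_ : List A → ℕ → Maybe A
  []       ! _     = nothing
  (x ∷ xs) ! zero  = just x
  (x ∷ xs) ! suc j = xs ! j

  !⇒< : ∀ (xs : List A) j → xs ! j ≡ just x → j < length xs
  !⇒< (_ ∷ _)  zero    _ = s≤s z≤n
  !⇒< (_ ∷ xs) (suc j) e = s≤s (!⇒< xs j e)

  !-++ˡ : ∀ (xs : List A) {ys} {j} → j < length xs → (xs ++ ys) ! j ≡ xs ! j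
  !-++ˡ (_ ∷ _)  {j = zero}  _         = refl
  !-++ˡ (_ ∷ xs) {j = suc j} (s≤s j<) = !-++ˡ xs j<

  !-++ʳ : ∀ (xs : List A) {ys} j → (xs ++ ys) ! (length xs + j) ≡ ys ! j
  !-++ʳ []       j = refl
  !-++ʳ (_ ∷ xs) j = !-++ʳ xs j

  !-drop : ∀ (xs : List A) q j → drop q xs ! j ≡ xs ! (q + j)
  !-drop []       zero    j = refl
  !-drop []       (suc q) j = refl
  !-drop (_ ∷ _)  zero    j = refl
  !-drop (_ ∷ xs) (suc q) j = !-drop xs q j

  !-take : ∀ (xs : List A) {n j} → j < n → take n xs ! j ≡ xs ! j
  !-take []       {suc n} _         = refl
  !-take (_ ∷ _)  {suc n} {zero} _  = refl
  !-take (_ ∷ xs) {suc n} {suc j} (s≤s j<n) = !-take xs j<n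

  <length-drop : ∀ (xs : List A) q {j} → j < length (drop q xs) → q + j < length xs
  <length-drop xs       zero    j< = j<
  <length-drop (_ ∷ xs) (suc q) j< = s≤s (<length-drop xs q j<)

  !⇒drop : ∀ (xs : List A) a → xs ! a ≡ just x → drop a xs ≡ x ∷ drop (suc a) xs
  !⇒drop (_ ∷ _)  zero    refl = refl
  !⇒drop (_ ∷ xs) (suc a) e    = !⇒drop xs a e

  <⇒!≡just : ∀ (xs : List A) j → j < length xs → ∃[ x ] xs ! j ≡ just x
  <⇒!≡just (x ∷ _)  zero    _         = x , refl
  <⇒!≡just (_ ∷ xs) (suc j) (s≤s j<) = <⇒!≡just xs j j<

  length-power : ∀ e (f : List A) → length (concat (replicate e f)) ≡ e * length f
  length-power zero    f = refl
  length-power (suc e) f = trans (length-++ f) (cong (length f +_) (length-power e f))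

  !-power : ∀ e (f : List A) .{{_ : NonZero (length f)}} j → j < length (concat (replicate e f)) →
            concat (replicate e f) ! j ≡ f ! (j % length f)
  !-power (suc e) f j j< with j <? length f
  ... | yes j<f = trans (!-++ˡ f j<f) (cong (f !_) (sym (m<n⇒m%n≡m j<f)))
  ... | no  j≮f with m≤n⇒∃[o]m+o≡n (≮⇒≥ j≮f)
  ... | k , refl = begin
    concat (replicate (suc e) f) ! (length f + k) ≡⟨ !-++ʳ f k ⟩
    concat (replicate e f) ! k                    ≡⟨ !-power e f k k< ⟩
    f ! (k % length f)                            ≡⟨ cong (f !_) ([m+n]%n≡m%n k (length f)) ⟨
    f ! ((k + length f) % length f)               ≡⟨ cong (λ i → f ! (i % length f)) (+-comm k (length f)) ⟩
    f ! ((length f + k) % length f)               ∎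
    where
    open ≡-Reasoning
    k< : k < length (concat (replicate e f))
    k< = +-cancelˡ-< (length f) k _ (subst (length f + k <_) (length-++ f) j<)

  record Occurs (s w : List A) (q : ℕ) : Set where
    constructor occurs
    field match : ∀ j → j < length w → s ! (q + j) ≡ w ! j
  open Occurs public

  infix 4 _⊑_
  _⊑_ : List A → List A → Set
  w ⊑ v = Occurs v w 0

  ⊑-++ : ∀ (w : List A) {t} → w ⊑ w ++ t
  ⊑-++ w = occurs λ j j< → !-++ˡ w j<

  ⊑⇒length≤ : w ⊑ v → length w ≤ length v
  ⊑⇒length≤ {w = []}    _   = z≤n
  ⊑⇒length≤ {w = x ∷ w} {v} w⊑v =
    !⇒< v (length w) (trans (match w⊑v (length w) ≤-refl) (proj₂ (<⇒!≡just (x ∷ w) (length w) ≤-refl)))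

  ∷-⊑⁻ : ∀ {y} → (x ∷ w) ⊑ (y ∷ v) → x ≡ y × w ⊑ v
  ∷-⊑⁻ w⊑v with refl ← match w⊑v 0 (s≤s z≤n) = refl , occurs λ j j< → match w⊑v (suc j) (s≤s j<)

  ⊑⇒take≡ : ∀ (w : List A) v → w ⊑ v → take (length w) v ≡ w
  ⊑⇒take≡ []      _       _   = refl
  ⊑⇒take≡ (x ∷ w) []      w⊑v with () ← match w⊑v 0 (s≤s z≤n)
  ⊑⇒take≡ (x ∷ w) (y ∷ v) w⊑v with refl , w⊑v′ ← ∷-⊑⁻ w⊑v = cong (y ∷_) (⊑⇒take≡ w v w⊑v′)

  IsLeftmost : List A → List A → ℕ → Set
  IsLeftmost s w q = Occurs s w q × (∀ q′ → Occurs s w q′ → q ≤ q′)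

  IsLeftmost-unique : ∀ {q q′} → IsLeftmost s w q → IsLeftmost s w q′ → q ≡ q′
  IsLeftmost-unique (o , min) (o′ , min′) = ≤-antisym (min _ o′) (min′ _ o)

  Occurs-⊑ : Occurs s w q → v ⊑ w → Occurs s v q
  Occurs-⊑ o v⊑w = occurs λ j j< → trans (match o j (<-≤-trans j< (⊑⇒length≤ v⊑w))) (match v⊑w j j<)

  Occurs-++ˡ : Occurs s (w ++ t) q → Occurs s w q
  Occurs-++ˡ {w = w} o = Occurs-⊑ o (⊑-++ w)

  Occurs-++ʳ : Occurs s (w ++ t) q → Occurs s t (q + length w)
  Occurs-++ʳ {s = s} {w = w} {t = t} {q = q} o = occurs λ j j< → begin
    s ! (q + length w + j)    ≡⟨ cong (s !_) (+-assoc q (length w) j) ⟩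
    s ! (q + (length w + j))  ≡⟨ match o (length w + j) (w+j< j<) ⟩
    (w ++ t) ! (length w + j) ≡⟨ !-++ʳ w j ⟩
    t ! j                     ∎
    where
    open ≡-Reasoning
    w+j< : ∀ {j} → j < length t → length w + j < length (w ++ t)
    w+j< j< = subst (length w + _ <_) (sym (length-++ w)) (+-monoʳ-< (length w) j<)

  Occurs⇒⊑ : Occurs s v q → Occurs s w q → length v ≤ length w → v ⊑ w
  Occurs⇒⊑ ov ow v≤w = occurs λ j j< → trans (sym (match ow j (<-≤-trans j< v≤w))) (match ov j j<)

  record Reads (s f : List A) .{{_ : NonZero (length f)}} (z L : ℕ) : Set where
    constructor reading
    field read : ∀ j → j < L → s ! (z + j) ≡ f ! (j % length f)
  open Reads public

  module _ {s f : List A} .{{_ : NonZero (length f)}} where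

    private
      n = length f

    Reads-prefix : Reads s f z L → j < n → j < L → s ! (z + j) ≡ f ! j
    Reads-prefix {z} {L} {j} r j<n j<L = trans (read r j j<L) (cong (f !_) (m<n⇒m%n≡m j<n))

    Reads-period : Reads s f z L → n + j < L → s ! (z + (n + j)) ≡ s ! (z + j)
    Reads-period {z} {L} {j} r n+j<L = begin
      s ! (z + (n + j))    ≡⟨ read r (n + j) n+j<L ⟩
      f ! ((n + j) % n)    ≡⟨ cong (λ i → f ! (i % n)) (+-comm n j) ⟩
      f ! ((j + n) % n)    ≡⟨ cong (f !_) ([m+n]%n≡m%n j n) ⟩
      f ! (j % n)          ≡⟨ read r j (≤-<-trans (m≤n+m j n) n+j<L) ⟨
      s ! (z + j)          ∎
      where open ≡-Reasoning

    Reads-copy : ∀ c → Reads s f z (e * n) → c < e → Reads s f (z + c * n) n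
    Reads-copy {z} {e} c r c<e = reading λ j j<n → begin
      s ! (z + c * n + j)   ≡⟨ cong (s !_) (+-assoc z (c * n) j) ⟩
      s ! (z + (c * n + j)) ≡⟨ read r (c * n + j) (within j<n) ⟩
      f ! ((c * n + j) % n) ≡⟨ cong (λ i → f ! (i % n)) (+-comm (c * n) j) ⟩
      f ! ((j + c * n) % n) ≡⟨ cong (f !_) ([m+kn]%n≡m%n j c n) ⟩
      f ! (j % n)           ∎
      where
      open ≡-Reasoning
      within : ∀ {j} → j < n → c * n + j < e * n
      within {j} j<n = <-≤-trans (subst (c * n + j <_) (+-comm (c * n) n) (+-monoʳ-< (c * n) j<n)) (*-monoˡ-≤ n c<e)

    power-Reads : Occurs s (concat (replicate e f)) z → Reads s f z (e * n)
    power-Reads {e} o = reading λ j j< →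
      let j<power = subst (j <_) (sym (length-power e f)) j< in
      trans (match o j j<power) (!-power e f j j<power)

    Reads-extend : 1 ≤ e → Occurs s (concat (replicate e f) ++ t) z → Occurs s t z →
                   Reads s f z (e * n + length t)
    Reads-extend {e} {t} {z} 1≤e o ot = reading (<-rec P step)
      where
      P : ℕ → Set _
      P j = j < e * n + length t → s ! (z + j) ≡ f ! (j % n)
      instance
        e≢0 : NonZero e
        e≢0 = >-nonZero 1≤e
      power : Reads s f z (e * n)
      power = power-Reads {e = e} (Occurs-++ˡ o)
      t-again : Occurs s t (z + e * n)
      t-again = subst (Occurs s t) (cong (z +_) (length-power e f)) (Occurs-++ʳ o)
      step : ∀ j → (∀ {k} → k < j → P k) → P j
      step j ih j< with j <? e * n
      ... | yes j<en = read power j j<en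
      ... | no  j≮en with m≤n⇒∃[o]m+o≡n (≮⇒≥ j≮en)
      ... | k , refl = begin
        s ! (z + (e * n + k)) ≡⟨ cong (s !_) (+-assoc z (e * n) k) ⟨
        s ! (z + e * n + k)   ≡⟨ match t-again k k< ⟩
        t ! k                 ≡⟨ match ot k k< ⟨
        s ! (z + k)           ≡⟨ ih (m<n+m k (≤-trans (>-nonZero⁻¹ n) (m≤n*m n e))) (≤-<-trans (m≤n+m k _) j<) ⟩
        f ! (k % n)           ≡⟨ cong (f !_) ([m+kn]%n≡m%n k e n) ⟨
        f ! ((k + e * n) % n) ≡⟨ cong (λ i → f ! (i % n)) (+-comm k (e * n)) ⟩
        f ! ((e * n + k) % n) ∎
        where
        open ≡-Reasoning
        k< : k < length t
        k< = +-cancelˡ-< (e * n) k _ j<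

    Reads⇒¬IsLeftmost : ∀ δ → Reads s f z L → IsLeftmost s w (z + (n + δ)) → n + δ + length w ≤ L → ⊥
    Reads⇒¬IsLeftmost {z} {L} {w} δ r (o , min) fits = <⇒≱ earlier (min (z + δ) shifted)
      where
      earlier : z + δ < z + (n + δ)
      earlier = +-monoʳ-< z (m<n+m δ (>-nonZero⁻¹ n))
      shifted : Occurs s w (z + δ)
      shifted = occurs λ j j< → begin
        s ! (z + δ + j)         ≡⟨ cong (s !_) (+-assoc z δ j) ⟩
        s ! (z + (δ + j))       ≡⟨ Reads-period r (<-≤-trans (n+δ+j< j<) fits) ⟨
        s ! (z + (n + (δ + j))) ≡⟨ cong (λ i → s ! (z + i)) (+-assoc n δ j) ⟨
        s ! (z + (n + δ + j))   ≡⟨ cong (s !_) (+-assoc z (n + δ) j) ⟨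
        s ! (z + (n + δ) + j)   ≡⟨ match o j j< ⟩
        w ! j                   ∎
        where
        open ≡-Reasoning
        n+δ+j< : ∀ {j} → j < length w → n + (δ + j) < n + δ + length w
        n+δ+j< {j} j< = subst (_< n + δ + length w) (+-assoc n δ j) (+-monoʳ-< (n + δ) j<)

  ⊑-trans : ∀ {u} → u ⊑ v → v ⊑ w → u ⊑ w
  ⊑-trans u⊑v v⊑w = Occurs-⊑ v⊑w u⊑v

  ⊑-power : ∀ {f : List A} → 1 ≤ e → f ⊑ concat (replicate e f)
  ⊑-power {f = f} (s≤s _) = ⊑-++ f

  All-! : ∀ {P : A → Set} → All P xs → xs ! a ≡ just x → P x
  All-! {a = zero}  (px ∷ _)   refl = px
  All-! {a = suc a} (_ ∷ pxs) eq   = All-! pxs eq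

  AllPairs-! : ∀ {_~_ : A → A → Set} → AllPairs _~_ xs → xs ! a ≡ just x → All (x ~_) (drop (suc a) xs)
  AllPairs-! {a = zero}  (x~ ∷ _)   refl = x~
  AllPairs-! {a = suc a} (_ ∷ pairs) eq  = AllPairs-! pairs eq

open Words

crossing : ∀ (h : ℕ → ℕ) K {x} → h K ≤ x → x < h 0 → ∃[ t ] t < K × h (suc t) ≤ x × x < h t
crossing h zero    hK≤x x<h0 = ⊥-elim (<⇒≱ x<h0 hK≤x)
crossing h (suc K) {x} hK≤x x<h0 with h K ≤? x
... | yes hK≤x′ = let t , t<K , rest = crossing h K hK≤x′ x<h0 in t , <-trans t<K (n<1+n K) , rest
... | no  hK≰x  = K , n<1+n K , hK≤x , ≰⇒> hK≰x

m∸n≡suc[m∸suc[n]] : ∀ {m n} → n < m → m ∸ n ≡ suc (m ∸ suc n)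
m∸n≡suc[m∸suc[n]] = +-∸-assoc 1

module Positions {A : Set} (_<ₐ_ : A → A → Set) where
  open L _<ₐ_

  OccursAt⇒Occurs : ∀ {s w q} → OccursAt s w q → Occurs s w q
  OccursAt⇒Occurs {s} {w} {q} eq = occurs λ j j< → begin
    s ! (q + j)                      ≡⟨ !-drop s q j ⟨
    drop q s ! j                     ≡⟨ !-take (drop q s) j< ⟨
    take (length w) (drop q s) ! j   ≡⟨ cong (_! j) eq ⟩
    w ! j                            ∎
    where open ≡-Reasoning

  Occurs⇒OccursAt : ∀ {s w q} → Occurs s w q → OccursAt s w q
  Occurs⇒OccursAt {s} {w} {q} o = ⊑⇒take≡ w (drop q s) (occurs λ j j< → trans (!-drop s q j) (match o j j<))

  Leftmost⇒IsLeftmost : ∀ {s w q} → Leftmost s w q → IsLeftmost s w q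
  Leftmost⇒IsLeftmost (o , min) = OccursAt⇒Occurs o , λ q′ o′ → min q′ (Occurs⇒OccursAt o′)

  pre-suc : ∀ R a {r} → R ! a ≡ just r → pre R (suc a) ≡ pre R a + length (runStr r)
  pre-suc (r ∷ _) zero    refl = +-comm (length (runStr r)) 0
  pre-suc (r ∷ R) (suc a) eq   =
    trans (cong (length (runStr r) +_) (pre-suc R a eq)) (sym (+-assoc (length (runStr r)) _ _))

  pre-mono : ∀ R {a b} → a ≤ b → pre R a ≤ pre R b
  pre-mono R       {zero}          _         = z≤n
  pre-mono []      {suc a} {suc b} _         = z≤n
  pre-mono (r ∷ R) {suc a} {suc b} (s≤s a≤b) = +-monoʳ-≤ (length (runStr r)) (pre-mono R a≤b)

  pre-locate : ∀ R a {x} → x < pre R a → ∃[ b ] b < a × pre R b ≤ x × x < pre R (suc b)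
  pre-locate (r ∷ R) (suc a) {x} x< with x <? length (runStr r)
  ... | yes x<r = 0 , s≤s z≤n , z≤n , subst (x <_) (sym (+-identityʳ _)) x<r
  ... | no  x≮r with m≤n⇒∃[o]m+o≡n (≮⇒≥ x≮r)
  ... | y , refl with pre-locate R a (+-cancelˡ-< (length (runStr r)) _ _ x<)
  ... | b , b<a , ≤y , y< = suc b , s≤s b<a , +-monoʳ-≤ (length (runStr r)) ≤y , +-monoʳ-< (length (runStr r)) y<

  drop-pre : ∀ R a → drop (pre R a) (concat (map runStr R)) ≡ concat (map runStr (drop a R))
  drop-pre R       zero    = refl
  drop-pre []      (suc a) = refl
  drop-pre (r ∷ R) (suc a) = trans (drop-++ (runStr r) (pre R a)) (drop-pre R a)
    where
    drop-++ : ∀ (u : List A) {v} k → drop (length u + k) (u ++ v) ≡ drop k v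
    drop-++ []      k = refl
    drop-++ (_ ∷ u) k = drop-++ u k

module LyndonWords {A : Set} {_<ₐ_ : A → A → Set} (sto : IsStrictTotalOrder _≡_ _<ₐ_) where
  open L _<ₐ_
  private
    module <ₐ = IsStrictTotalOrder sto
    variable
      f g h u v w : List A
      s : List A
      z L : ℕ

  ≺-trans : u ≺ v → v ≺ w → u ≺ w
  ≺-trans []≺        (here _)   = []≺
  ≺-trans []≺        (there _)  = []≺
  ≺-trans (here x<y) (here y<z) = here (<ₐ.trans x<y y<z)
  ≺-trans (here x<y) (there _)  = here x<y
  ≺-trans (there _)  (here y<z) = here y<z
  ≺-trans (there u≺v) (there v≺w) = there (≺-trans u≺v v≺w)

  ≺-irrefl : ¬ w ≺ w
  ≺-irrefl (here x<x)  = <ₐ.irrefl refl x<x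
  ≺-irrefl (there w≺w) = ≺-irrefl w≺w

  ≺-asym : u ≺ v → ¬ v ≺ u
  ≺-asym u≺v v≺u = ≺-irrefl (≺-trans u≺v v≺u)

  ∷-⊑ : ∀ {x} → v ⊑ w → (x ∷ v) ⊑ (x ∷ w)
  ∷-⊑ v⊑w = occurs λ where
    zero    _        → refl
    (suc j) (s≤s j<) → match v⊑w j j<

  ⊑∧<⇒≺ : ∀ v w → v ⊑ w → length v < length w → v ≺ w
  ⊑∧<⇒≺ []      (_ ∷ _) _   _        = []≺
  ⊑∧<⇒≺ (x ∷ v) (y ∷ w) v⊑w (s≤s v<w) with refl , v⊑w′ ← ∷-⊑⁻ v⊑w = there (⊑∧<⇒≺ v w v⊑w′ v<w)

  ⊑⇒⊀ : ∀ v w → v ⊑ w → ¬ w ≺ v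
  ⊑⇒⊀ (x ∷ v) []      v⊑w []≺ with () ← match v⊑w 0 (s≤s z≤n)
  ⊑⇒⊀ (x ∷ v) (y ∷ w) v⊑w (here y<x)  with refl , _ ← ∷-⊑⁻ v⊑w = <ₐ.irrefl refl y<x
  ⊑⇒⊀ (x ∷ v) (y ∷ w) v⊑w (there w≺v) with _ , v⊑w′ ← ∷-⊑⁻ v⊑w = ⊑⇒⊀ v w v⊑w′ w≺v

  ≺-agree : ∀ v → w ≺ u → length u ≤ length w →
            (∀ j → j < length v → j < length u → v ! j ≡ u ! j) → w ≺ v ⊎ v ⊑ w
  ≺-agree []      _           _        _  = inj₂ (occurs λ _ ())
  ≺-agree (x ∷ v) (here x<y)  _        ag with refl ← ag 0 (s≤s z≤n) (s≤s z≤n) = inj₁ (here x<y)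
  ≺-agree (x ∷ v) (there w≺u) (s≤s le) ag with refl ← ag 0 (s≤s z≤n) (s≤s z≤n) =
    Sum.map there ∷-⊑ (≺-agree v w≺u le λ j j<v j<u → ag (suc j) (s≤s j<v) (s≤s j<u))

  Lyndon⇒NonZero : Lyndon f → NonZero (length f)
  Lyndon⇒NonZero {[]}    (f≢[] , _) = ⊥-elim (f≢[] refl)
  Lyndon⇒NonZero {_ ∷ _} _          = _

  Lyndon-≺-suffix : Lyndon f → f ≡ u ++ v → v ≢ [] → g ≺ f → g ≺ v
  Lyndon-≺-suffix {u = []}    _              refl _    g≺f = g≺f
  Lyndon-≺-suffix {u = _ ∷ _} (_ , ≺suffix) f≡uv v≢[] g≺f = ≺-trans g≺f (≺suffix _ _ (λ ()) v≢[] f≡uv)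

  Lyndon-≺-drop : Lyndon f → ∀ δ → 0 < δ → δ < length f → f ≺ drop δ f
  Lyndon-≺-drop {f} (_ , ≺suffix) δ 0<δ δ<f =
    ≺suffix (take δ f) (drop δ f) (take≢[] f 0<δ δ<f) (drop≢[] f δ<f) (sym (take++drop≡id δ f))
    where
    take≢[] : ∀ (f : List A) {δ} → 0 < δ → δ < length f → take δ f ≢ []
    take≢[] (_ ∷ _) {suc _} _ _ ()
    drop≢[] : ∀ (f : List A) {δ} → δ < length f → drop δ f ≢ []
    drop≢[] (_ ∷ _) {zero}  _         ()
    drop≢[] (_ ∷ f) {suc δ} (s≤s δ<f) = drop≢[] f δ<f

  Lyndon-shift : Lyndon w → ∀ y → y < length w →
                 (∀ j → j < length v → y + j < length w → v ! j ≡ w ! (y + j)) → w ≺ v ⊎ v ⊑ w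
  Lyndon-shift {w} {v} _ zero _ ag with length v ≤? length w
  ... | yes v≤w = inj₂ (occurs λ j j< → sym (ag j j< (<-≤-trans j< v≤w)))
  ... | no  v≰w = inj₁ (⊑∧<⇒≺ w v (occurs λ j j< → ag j (<-trans j< (≰⇒> v≰w)) j<) (≰⇒> v≰w))
  Lyndon-shift {w} {v} lyn y@(suc _) y<w ag =
    ≺-agree v (Lyndon-≺-drop lyn y (s≤s z≤n) y<w) (subst (_≤ length w) (sym (length-drop y w)) (m∸n≤m _ y))
      λ j j<v j<u → trans (ag j j<v (<length-drop w y j<u)) (sym (!-drop w y j))

  Reads-Lyndon-shift : .{{_ : NonZero (length f)}} → Lyndon f → Reads s f z L → length f ≤ L →
                       ∀ δ → δ < length f → Occurs s w (z + δ) → f ≺ w ⊎ w ⊑ f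
  Reads-Lyndon-shift {f} {s} {z} {w = w} lyn r f≤L δ δ<f o = Lyndon-shift lyn δ δ<f agree
    where
    agree : ∀ j → j < length w → δ + j < length f → w ! j ≡ f ! (δ + j)
    agree j j<w δ+j<f = begin
      w ! j             ≡⟨ match o j j<w ⟨
      s ! (z + δ + j)   ≡⟨ cong (s !_) (+-assoc z δ j) ⟩
      s ! (z + (δ + j)) ≡⟨ Reads-prefix r δ+j<f (<-≤-trans δ+j<f f≤L) ⟩
      f ! (δ + j)       ∎
      where open ≡-Reasoning

  Lyndon-aperiodic : Lyndon g → ∀ π → 0 < π → π < length g → ¬ (∀ j → π + j < length g → g ! (π + j) ≡ g ! j)
  Lyndon-aperiodic {g} lyn π 0<π π<g period =
    ⊑⇒⊀ (drop π g) g suffix⊑g (Lyndon-≺-drop lyn π 0<π π<g)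
    where
    suffix⊑g : drop π g ⊑ g
    suffix⊑g = occurs λ j j< → trans (sym (period j (<length-drop g π j<))) (sym (!-drop g π j))

  Lyndon-Reads⇒⊑ : .{{_ : NonZero (length h)}} →
                   Lyndon g → Reads s h z L → Occurs s g z → length g ≤ L → g ⊑ h
  Lyndon-Reads⇒⊑ {h} {g} {s} {z} lyn r o g≤L with length g ≤? length h
  ... | yes g≤h = occurs λ j j< → trans (sym (Reads-prefix r (<-≤-trans j< g≤h) (<-≤-trans j< g≤L))) (match o j j<)
  ... | no  g≰h = ⊥-elim (Lyndon-aperiodic lyn (length h) (>-nonZero⁻¹ _) (≰⇒> g≰h) period)
    where
    period : ∀ j → length h + j < length g → g ! (length h + j) ≡ g ! j
    period j h+j< = begin
      g ! (length h + j)       ≡⟨ match o _ h+j< ⟨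
      s ! (z + (length h + j)) ≡⟨ Reads-period r (<-≤-trans h+j< g≤L) ⟩
      s ! (z + j)              ≡⟨ match o j (≤-<-trans (m≤n+m j _) h+j<) ⟩
      g ! j                    ∎
      where open ≡-Reasoning

  Lyndon-suffix-⋢-concat : Lyndon f → ∀ ws → All (_≺ f) ws → f ≡ u ++ v → v ≢ [] → ¬ v ⊑ concat ws
  Lyndon-suffix-⋢-concat {v = []}    _ [] _ _ v≢[] _    = v≢[] refl
  Lyndon-suffix-⋢-concat {v = _ ∷ _} _ [] _ _ _    v⊑[] with () ← match v⊑[] 0 (s≤s z≤n)
  Lyndon-suffix-⋢-concat {f} {u} {v} lyn (g ∷ ws) (g≺f ∷ ws≺f) f≡uv v≢[] v⊑gws
    with length v ≤? length g
  ... | yes v≤g = ⊑⇒⊀ v g v⊑g (Lyndon-≺-suffix lyn f≡uv v≢[] g≺f)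
    where
    v⊑g : v ⊑ g
    v⊑g = occurs λ j j< → trans (sym (!-++ˡ g (<-≤-trans j< v≤g))) (match v⊑gws j j<)
  ... | no  v≰g = Lyndon-suffix-⋢-concat lyn ws ws≺f f≡uv′ rest≢[] rest⊑ws
    where
    g<v = ≰⇒> v≰g
    rest = drop (length g) v
    f≡uv′ : f ≡ (u ++ take (length g) v) ++ rest
    f≡uv′ = trans f≡uv (trans (cong (u ++_) (sym (take++drop≡id (length g) v))) (sym (++-assoc u _ _)))
    rest≢[] : rest ≢ []
    rest≢[] rest≡[] = <⇒≱ g<v (m∸n≡0⇒m≤n (trans (sym (length-drop (length g) v)) (cong length rest≡[])))
    rest⊑ws : rest ⊑ concat ws
    rest⊑ws = occurs λ j j< → let open ≡-Reasoning in begin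
      concat ws ! j                     ≡⟨ !-++ʳ g j ⟨
      (g ++ concat ws) ! (length g + j) ≡⟨ match v⊑gws _ (<length-drop v (length g) j<) ⟩
      v ! (length g + j)                ≡⟨ !-drop v (length g) j ⟨
      rest ! j                          ∎

  roots : List Run → List (List A)
  roots []             = []
  roots ((g , e) ∷ rs) = replicate e g ++ roots rs

  concat-roots : ∀ rs → concat (map runStr rs) ≡ concat (roots rs)
  concat-roots []             = refl
  concat-roots ((g , e) ∷ rs) = trans (cong (runStr (g , e) ++_) (concat-roots rs)) (concat-++ (replicate e g) (roots rs))

  Lyndon-⋢-runs : Lyndon f → ∀ rs → All (λ r → proj₁ r ≺ f) rs → ¬ f ⊑ concat (map runStr rs)
  Lyndon-⋢-runs {f} lyn rs rs≺f f⊑rs =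
    Lyndon-suffix-⋢-concat lyn (roots rs) (All-roots rs rs≺f) refl (proj₁ lyn) (subst (f ⊑_) (concat-roots rs) f⊑rs)
    where
    All-roots : ∀ rs → All (λ r → proj₁ r ≺ f) rs → All (_≺ f) (roots rs)
    All-roots []             []           = []
    All-roots ((_ , e) ∷ rs) (g≺f ∷ rs≺f) = ++⁺ (replicate⁺ e g≺f) (All-roots rs rs≺f)

module Factorization {A : Set} {_<ₐ_ : A → A → Set} (sto : IsStrictTotalOrder _≡_ _<ₐ_)
                     (s : List A) (R : List (L.Run _<ₐ_)) (LF : L.IsLyndonFactorization _<ₐ_ s R) where
  open L _<ₐ_
  open LyndonWords sto
  open Positions _<ₐ_

  pos : ℕ → ℕ
  pos = pre R

  -- Runs are counted from 0 here: pos a is where F_{a+1} starts and runs a c = F_{a+1}⋯F_{a+c}.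
  runs : ℕ → ℕ → List A
  runs a c = W R (suc a) c

  RunAt : ℕ → List A → ℕ → Set
  RunAt a f e = R ! a ≡ just (f , e)

  private
    variable
      a b c e e′ ea x : ℕ
      f f′ g fa : List A

  run-exists : a < length R → ∃₂ λ f e → RunAt a f e
  run-exists {a} a< = let (f , e) , eq = <⇒!≡just R a a< in f , e , eq

  root-Lyndon : RunAt a f e → Lyndon f
  root-Lyndon = All-! (proj₁ (proj₂ LF))

  root-NonZero : RunAt a f e → NonZero (length f)
  root-NonZero ra = Lyndon⇒NonZero (root-Lyndon ra)

  exponent-positive : RunAt a f e → 1 ≤ e
  exponent-positive = All-! (proj₁ (proj₂ (proj₂ LF)))

  later-roots-smaller : RunAt a f e → All (λ r → proj₁ r ≺ f) (drop (suc a) R)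
  later-roots-smaller = AllPairs-! (Linked⇒AllPairs (λ g≺f h≺g → ≺-trans h≺g g≺f) (proj₂ (proj₂ (proj₂ LF))))

  roots-decreasing : RunAt a f e → RunAt b g e′ → a < b → g ≺ f
  roots-decreasing {a} ra rb a<b with m≤n⇒∃[o]m+o≡n a<b
  ... | k , refl = All-! (later-roots-smaller ra) (trans (!-drop R (suc a) k) rb)

  root-⊀-later : RunAt a f e → RunAt b g e′ → a ≤ b → ¬ f ≺ g
  root-⊀-later {a} {b = b} ra rb a≤b f≺g with a ≟ b
  ... | yes refl with refl ← trans (sym ra) rb = ≺-irrefl f≺g
  ... | no  a≢b  = ≺-asym f≺g (roots-decreasing ra rb (≤∧≢⇒< a≤b a≢b))

  runs-suc : RunAt a f e → ∀ c → runs a (suc c) ≡ runStr (f , e) ++ runs (suc a) c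
  runs-suc {a} ra c = cong (λ rs → concat (map runStr (take (suc c) rs))) (!⇒drop R a ra)

  pos-suc : RunAt a f e → pos (suc a) ≡ pos a + length (runStr (f , e))
  pos-suc {a} ra = pre-suc R a ra

  runs-Occurs : ∀ a c → Occurs s (runs a c) (pos a)
  runs-Occurs a c = occurs λ j j< → begin
    s ! (pos a + j)                                           ≡⟨ !-drop s (pos a) j ⟨
    drop (pos a) s ! j                                        ≡⟨ cong (λ t → drop (pos a) t ! j) (proj₁ LF) ⟨
    drop (pos a) (concat (map runStr R)) ! j                  ≡⟨ cong (_! j) (drop-pre R a) ⟩
    concat (map runStr (drop a R)) ! j                        ≡⟨ cong (_! j) runs++rest ⟨
    (runs a c ++ concat (map runStr (drop c (drop a R)))) ! j ≡⟨ !-++ˡ (runs a c) j< ⟩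
    runs a c ! j                                              ∎
    where
    open ≡-Reasoning
    runs++rest : runs a c ++ concat (map runStr (drop c (drop a R))) ≡ concat (map runStr (drop a R))
    runs++rest = trans (concat-++ (map runStr (take c rs)) (map runStr (drop c rs)))
                       (cong concat (trans (sym (map-++ runStr (take c rs) (drop c rs)))
                                           (cong (map runStr) (take++drop≡id c rs))))
      where rs = drop a R

  power-Occurs : RunAt a f e → Occurs s (runStr (f , e)) (pos a)
  power-Occurs {a} ra = Occurs-++ˡ (subst (λ w → Occurs s w (pos a)) (runs-suc ra 0) (runs-Occurs a 1))

  root⊑runs : RunAt a f e → ∀ c → f ⊑ runs a (suc c)
  root⊑runs {f = f} {e} ra c =
    subst (f ⊑_) (sym (runs-suc ra c)) (⊑-trans (⊑-power (exponent-positive ra)) (⊑-++ (runStr (f , e))))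

  root-Occurs : RunAt a f e → Occurs s f (pos a)
  root-Occurs {a} ra = Occurs-⊑ (runs-Occurs a 1) (root⊑runs ra 0)

  pos-locate : x < pos a → ∃[ b ] b < a × pos b ≤ x × x < pos (suc b)
  pos-locate {a = a} = pre-locate R a

  run-Reads : .{{_ : NonZero (length f)}} → RunAt a f e → Reads s f (pos a) (e * length f)
  run-Reads {f = f} {e = e} ra = power-Reads {f = f} {e = e} (power-Occurs ra)

  root≤power : RunAt a f e → length f ≤ length (runStr (f , e))
  root≤power ra = ⊑⇒length≤ (⊑-power (exponent-positive ra))

  Leftmost-root<next-pos : RunAt b f e → IsLeftmost s f x → x < pos (suc b)
  Leftmost-root<next-pos {b} {f} {e} {x} rb (_ , min) = begin-strict
    x                               ≤⟨ min (pos b) (root-Occurs rb) ⟩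
    pos b                           <⟨ m<m+n (pos b) (<-≤-trans (>-nonZero⁻¹ _) (root≤power rb)) ⟩
    pos b + length (runStr (f , e)) ≡⟨ pos-suc rb ⟨
    pos (suc b)                     ∎
    where
    open ≤-Reasoning
    instance _ = root-NonZero rb

  -- x lies in some copy of fa, so Lyndon-shift makes f a prefix of fa (as fa ⪰ f),
  -- and f already occurs at the start of run a.
  Leftmost-root-in-run : RunAt b f e → RunAt a fa ea → a ≤ b → IsLeftmost s f x →
                         pos a ≤ x → x < pos (suc a) → x ≡ pos a
  Leftmost-root-in-run {f = f} {a = a} {fa} {ea} rb ra a≤b (ox , min) pos≤x x<next
    with δ , refl ← m≤n⇒∃[o]m+o≡n pos≤x
    = ≤-antisym (min (pos a) (Occurs-⊑ (root-Occurs ra) f⊑fa)) (m≤m+n (pos a) δ)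
    where
    instance
      fa≢[] : NonZero (length fa)
      fa≢[] = root-NonZero ra
    n = length fa
    δ≡ : δ ≡ δ % n + δ / n * n
    δ≡ = m≡m%n+[m/n]*n δ n
    δ< : δ < ea * n
    δ< = +-cancelˡ-< (pos a) δ _ (subst (pos a + δ <_) (trans (pos-suc ra) (cong (pos a +_) (length-power ea fa))) x<next)
    copy : Reads s fa (pos a + δ / n * n) n
    copy = Reads-copy {e = ea} (δ / n) (run-Reads ra) (m<n*o⇒m/o<n δ<)
    f-in-copy : Occurs s f (pos a + δ / n * n + δ % n)
    f-in-copy = subst (Occurs s f) (trans (cong (pos a +_) (trans δ≡ (+-comm (δ % n) _))) (sym (+-assoc (pos a) _ _))) ox
    f⊑fa : f ⊑ fa
    f⊑fa with Reads-Lyndon-shift (root-Lyndon ra) copy ≤-refl (δ % n) (m%n<n δ n) f-in-copy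
    ... | inj₁ fa≺f = ⊥-elim (root-⊀-later ra rb a≤b fa≺f)
    ... | inj₂ f⊑fa = f⊑fa

  Leftmost-root⇒pos : RunAt b f e → IsLeftmost s f x → ∃[ a ] a ≤ b × x ≡ pos a
  Leftmost-root⇒pos {b} rb lm
    with a , s≤s a≤b , pos≤x , x<next ← pos-locate {a = suc b} (Leftmost-root<next-pos rb lm)
    with _ , _ , ra ← run-exists (≤-<-trans a≤b (!⇒< R b rb))
    = a , a≤b , Leftmost-root-in-run rb ra a≤b lm pos≤x x<next

  record Piece (a n q : ℕ) : Set where
    field
      tail-nonempty : 1 ≤ n
      next-run      : suc a < length R
      tail-leftmost : IsLeftmost s (runs (suc a) n) q
      whole-occurs  : Occurs s (runs a (suc n)) q

  InPiece : ℕ → ℕ → ℕ → ℕ → Set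
  InPiece a n q x = q + length (runs (suc a) n) ≤ x × x < q + length (runs a (suc n))

  piece-run : ∀ {n q} → Piece a n q → ∃₂ (RunAt a)
  piece-run P = run-exists (<-trans (n<1+n _) (Piece.next-run P))

  module PieceFacts {a n q} (P : Piece a n q) {f e} (ra : RunAt a f e) where
    open Piece P

    instance
      root≢[] : NonZero (length f)
      root≢[] = root-NonZero ra

    piece-Reads : Reads s f q (length (runs a (suc n)))
    piece-Reads = subst (Reads s f q) (sym length-whole)
                        (Reads-extend (exponent-positive ra) power-then-tail (proj₁ tail-leftmost))
      where
      length-whole : length (runs a (suc n)) ≡ e * length f + length (runs (suc a) n)
      power-then-tail = subst (λ w → Occurs s w q) (runs-suc ra n) whole-occurs
      length-whole = trans (cong length (runs-suc ra n)) (trans (length-++ (runStr (f , e))) (cong (_+ _) (length-power e f)))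

    root-occurs : Occurs s f q
    root-occurs = Occurs-⊑ whole-occurs (root⊑runs ra n)

    root≤whole : length f ≤ length (runs a (suc n))
    root≤whole = ⊑⇒length≤ (root⊑runs ra n)

    tail<root : length (runs (suc a) n) < length f
    tail<root with length (runs (suc a) n) <? length f
    ... | yes tail<f = tail<f
    ... | no  tail≮f = ⊥-elim (Lyndon-⋢-runs (root-Lyndon ra) _ (take⁺ n (later-roots-smaller ra))
                                 (Occurs⇒⊑ root-occurs (proj₁ tail-leftmost) (≮⇒≥ tail≮f)))

    tail⊑root : runs (suc a) n ⊑ f
    tail⊑root = Occurs⇒⊑ (proj₁ tail-leftmost) root-occurs (<⇒≤ tail<root)

    piece-at-pos : ∃[ b ] b ≤ a × q ≡ pos b
    piece-at-pos = Leftmost-root⇒pos ra (root-occurs , λ q′ o → proj₂ tail-leftmost q′ (Occurs-⊑ o tail⊑root))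

  piece-next-root⊑tail : ∀ {n q e₁} → Piece a n q → RunAt (suc a) g e₁ → g ⊑ runs (suc a) n
  piece-next-root⊑tail {a} {g} {n} P rg = subst (g ⊑_) (cong (runs (suc a)) (suc-pred n)) (root⊑runs rg (pred n))
    where instance _ = >-nonZero (Piece.tail-nonempty P)

  private
    variable
      n n′ q q′ a′ : ℕ

  tail-not-after-root : Piece a n q → RunAt a f e → Piece a′ n′ q′ →
                        q + length f ≤ q′ → q′ + length (runs (suc a′) n′) ≤ q + length (runs a (suc n)) → ⊥
  tail-not-after-root {a} {n} {q} {f} {a′ = a′} {n′} P ra P′ q+f≤q′ ends-inside
    with δ , refl ← m≤n⇒∃[o]m+o≡n q+f≤q′
    = Reads⇒¬IsLeftmost {{root-NonZero ra}} δ (PieceFacts.piece-Reads P ra) tail′-leftmost fits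
    where
    tail′ = runs (suc a′) n′
    tail′-leftmost : IsLeftmost s tail′ (q + (length f + δ))
    tail′-leftmost = subst (IsLeftmost s tail′) (+-assoc q (length f) δ) (Piece.tail-leftmost P′)
    fits : length f + δ + length tail′ ≤ length (runs a (suc n))
    fits = +-cancelˡ-≤ q _ _ (begin
      q + (length f + δ + length tail′) ≡⟨ +-assoc q (length f + δ) _ ⟨
      q + (length f + δ) + length tail′ ≡⟨ cong (_+ length tail′) (+-assoc q (length f) δ) ⟨
      q + length f + δ + length tail′   ≤⟨ ends-inside ⟩
      q + length (runs a (suc n))       ∎)
      where open ≤-Reasoning

  -- f′ occurs inside the first copy of f and f′ ≺ f, so Lyndon-shift makes f′, and with it the tail
  -- of P′, occur at q < q′.
  later-start-within-root : Piece a n q → RunAt a f e → Piece a′ n′ q′ → RunAt a′ f′ e′ → a < a′ →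
                            q < q′ → q′ < q + length f → ⊥
  later-start-within-root {q = q} {f = f} P ra P′ ra′ a<a′ q<q′ q′<q+f
    with δ , refl ← m≤n⇒∃[o]m+o≡n (<⇒≤ q<q′)
    with Reads-Lyndon-shift {{root-NonZero ra}} (root-Lyndon ra)
           (PieceFacts.piece-Reads P ra) (PieceFacts.root≤whole P ra)
           δ (+-cancelˡ-< q δ _ q′<q+f) (PieceFacts.root-occurs P′ ra′)
  ... | inj₁ f≺f′ = ≺-asym f≺f′ (roots-decreasing ra ra′ a<a′)
  ... | inj₂ f′⊑f = <⇒≱ q<q′ (proj₂ (Piece.tail-leftmost P′) q
                       (Occurs-⊑ (Occurs-⊑ (PieceFacts.root-occurs P ra) f′⊑f) (PieceFacts.tail⊑root P′ ra′)))

  pos+root≤pos : RunAt b f e → b < c → pos b + length f ≤ pos c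
  pos+root≤pos {b} {f} {e} {c} rb b<c = begin
    pos b + length f                ≤⟨ +-monoʳ-≤ (pos b) (root≤power rb) ⟩
    pos b + length (runStr (f , e)) ≡⟨ pos-suc rb ⟨
    pos (suc b)                     ≤⟨ pre-mono R b<c ⟩
    pos c                           ∎
    where open ≤-Reasoning

  -- q′ and q start runs b′ < b, so the root of run b′ ends by q and is a proper prefix of f′,
  -- although f′, the root of the later run a′, must be smaller.
  earlier-start-within-root : Piece a n q → RunAt a f e → Piece a′ n′ q′ → RunAt a′ f′ e′ → a < a′ →
                              q′ < q → q < q′ + length f′ → ⊥
  earlier-start-within-root {a = a} {f′ = f′} P ra P′ ra′ a<a′ q′<q q<q′+f′
    with b , b≤a , refl ← PieceFacts.piece-at-pos P ra
    with b′ , b′≤a′ , refl ← PieceFacts.piece-at-pos P′ ra′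
    with fb , _ , rb′ ← run-exists (≤-<-trans b′≤a′ (!⇒< R _ ra′))
    = ≺-asym (⊑∧<⇒≺ fb f′ fb⊑f′ fb<f′) (roots-decreasing rb′ ra′ (<-≤-trans b′<b (≤-trans b≤a (<⇒≤ a<a′))))
    where
    b′<b : b′ < b
    b′<b = ≰⇒> λ b≤b′ → <⇒≱ q′<q (pre-mono R b≤b′)
    fb<f′ : length fb < length f′
    fb<f′ = +-cancelˡ-< (pos b′) _ _ (≤-<-trans (pos+root≤pos rb′ b′<b) q<q′+f′)
    fb⊑f′ : fb ⊑ f′
    fb⊑f′ = Occurs⇒⊑ (root-Occurs rb′) (PieceFacts.root-occurs P′ ra′) (<⇒≤ fb<f′)

  -- The root g of run a + 1 starts the tail of P, hence lies in the window where s reads f′^∞;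
  -- a Lyndon word there is a prefix of f′, yet f′ ≺ g.
  same-start : Piece a n q → Piece a′ n′ q → RunAt a′ f′ e′ → suc a < a′ →
               length (runs (suc a) n) < length (runs a′ (suc n′)) → ⊥
  same-start {f′ = f′} P P′ ra′ a+1<a′ tail<whole′
    with g , _ , rg ← run-exists (Piece.next-run P)
    = ⊑⇒⊀ g f′ g⊑f′ (roots-decreasing rg ra′ a+1<a′)
    where
    g⊑tail = piece-next-root⊑tail P rg
    g⊑f′ : g ⊑ f′
    g⊑f′ = Lyndon-Reads⇒⊑ {{root-NonZero ra′}} (root-Lyndon rg) (PieceFacts.piece-Reads P′ ra′)
             (Occurs-⊑ (proj₁ (Piece.tail-leftmost P)) g⊑tail) (≤-trans (⊑⇒length≤ g⊑tail) (<⇒≤ tail<whole′))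

  pieces-disjoint : Piece a n q → Piece a′ n′ q′ → 2 + a ≤ a′ → InPiece a n q x → InPiece a′ n′ q′ x → ⊥
  pieces-disjoint {a} {q = q} {q′ = q′} P P′ a+2≤a′ (tail≤x , x<whole) (tail′≤x , x<whole′)
    with f , _ , ra ← piece-run P
    with f′ , _ , ra′ ← piece-run P′
    with <-cmp q q′
  ... | tri≈ _ refl _ = same-start P P′ ra′ a+2≤a′ (+-cancelˡ-< q _ _ (≤-<-trans tail≤x x<whole′))
  ... | tri< q<q′ _ _ = case q′ <? q + length f of λ where
    (yes q′<q+f) → later-start-within-root P ra P′ ra′ (<-trans (n<1+n a) a+2≤a′) q<q′ q′<q+f
    (no  q′≮q+f) → tail-not-after-root P ra P′ (≮⇒≥ q′≮q+f) (<⇒≤ (≤-<-trans tail′≤x x<whole))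
  ... | tri> _ _ q′<q = case q <? q′ + length f′ of λ where
    (yes q<q′+f′) → earlier-start-within-root P ra P′ ra′ (<-trans (n<1+n a) a+2≤a′) q′<q q<q′+f′
    (no  q≮q′+f′) → tail-not-after-root P′ ra′ P (≮⇒≥ q≮q′+f′) (<⇒≤ (≤-<-trans tail≤x x<whole′))

  record PieceCovering (i p x : ℕ) : Set where
    field
      {first size start} : ℕ
      piece    : Piece first size start
      from-i   : i ∸ 1 ≤ first
      below    : 2 + first ≤ i + p ∸ 1
      contains : InPiece first size start x

  -- The first hypothesis says that the extended domains of a (1 + p′)-group all start at q.
  chain-covering : ∀ {i₀ K p′ q x} → (∀ t → t ≤ p′ → IsLeftmost s (runs (i₀ + t) (K ∸ t)) q) →
                   p′ < K → i₀ + p′ < length R →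
                   q + length (runs (i₀ + p′) (K ∸ p′)) ≤ x → x < q + length (runs i₀ K) →
                   PieceCovering (suc i₀) (suc p′) x
  chain-covering {i₀} {K} {p′} {q} {x} leftmost p′<K in-range last≤x x<first =
    record { piece = piece ; from-i = m≤m+n i₀ t ; below = a+2≤ ; contains = next≤x′ , x<this′ }
    where
    crossed = crossing (λ t → q + length (runs (i₀ + t) (K ∸ t))) p′ last≤x
                       (subst (λ j → x < q + length (runs j K)) (sym (+-identityʳ i₀)) x<first)
    t = proj₁ crossed
    t<p′ = proj₁ (proj₂ crossed)
    K∸t≡ : K ∸ t ≡ suc (K ∸ suc t)
    K∸t≡ = m∸n≡suc[m∸suc[n]] (<-trans t<p′ p′<K)
    a+2≤ : 2 + (i₀ + t) ≤ i₀ + suc p′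
    a+2≤ = subst (2 + (i₀ + t) ≤_) (sym (+-suc i₀ p′)) (s≤s (+-monoʳ-< i₀ t<p′))
    piece : Piece (i₀ + t) (K ∸ suc t) q
    piece = record
      { tail-nonempty = m<n⇒0<n∸m (≤-<-trans t<p′ p′<K)
      ; next-run      = ≤-trans (s≤s (+-monoʳ-< i₀ t<p′)) in-range
      ; tail-leftmost = subst (λ j → IsLeftmost s (runs j (K ∸ suc t)) q) (+-suc i₀ t) (leftmost (suc t) t<p′)
      ; whole-occurs  = subst (λ c → Occurs s (runs (i₀ + t) c) q) K∸t≡ (proj₁ (leftmost t (<⇒≤ t<p′)))
      }
    next≤x′ : q + length (runs (suc (i₀ + t)) (K ∸ suc t)) ≤ x
    next≤x′ = subst (λ j → q + length (runs j (K ∸ suc t)) ≤ x) (+-suc i₀ t) (proj₁ (proj₂ (proj₂ crossed)))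
    x<this′ : x < q + length (runs (i₀ + t) (suc (K ∸ suc t)))
    x<this′ = subst (λ c → x < q + length (runs (i₀ + t) c)) K∸t≡ (proj₂ (proj₂ (proj₂ crossed)))

  group-covering : ∀ {d p i j₁ j₂ x} → PGroup s R d p i → Assoc s R d p i (j₁ , j₂) → j₁ ≤ x × x < j₂ →
                PieceCovering i p x
  group-covering {suc d₀} {suc p′} {suc i₀} {x = x}
              (_ , _ , _ , fits , (Q , _) , ext) (q , leftmost-whole , refl , refl) (j₁≤x , x<j₂)
    = chain-covering leftmost (≤-trans (n<1+n p′) (m≤n+m (suc p′) d₀)) in-range
                     (subst (_≤ x) last-domain j₁≤x) x<j₂
    where
    K = d₀ + suc p′
    Q≡q : Q ≡ q
    Q≡q = IsLeftmost-unique (subst (λ j → IsLeftmost s (runs j K) Q) (+-identityʳ i₀) first-domain)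
                            (Leftmost⇒IsLeftmost leftmost-whole)
      where first-domain = Leftmost⇒IsLeftmost (proj₁ (ext 0 (s≤s z≤n)))
    leftmost : ∀ t → t ≤ p′ → IsLeftmost s (runs (i₀ + t) (K ∸ t)) q
    leftmost t t≤p′ = subst (IsLeftmost s _) Q≡q (Leftmost⇒IsLeftmost (proj₁ (ext t (s≤s t≤p′))))
    in-range : i₀ + p′ < length R
    in-range = begin-strict
      i₀ + p′                  ≤⟨ +-monoˡ-≤ p′ (m≤m+n i₀ d₀) ⟩
      i₀ + d₀ + p′             <⟨ n<1+n _ ⟩
      suc (i₀ + d₀ + p′)       ≡⟨ +-suc (i₀ + d₀) p′ ⟨
      i₀ + d₀ + suc p′         ≡⟨ cong (λ m → m + suc p′ ∸ 1) (+-suc i₀ d₀) ⟨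
      i₀ + suc d₀ + suc p′ ∸ 1 ≤⟨ fits ⟩
      length R                 ∎
      where open ≤-Reasoning
    last-domain : q + length (runs (i₀ + suc p′ ∸ 1) (suc d₀)) ≡ q + length (runs (i₀ + p′) (K ∸ p′))
    last-domain = cong₂ (λ j c → q + length (runs j c)) (cong (_∸ 1) (+-suc i₀ p′))
                        (sym (trans (cong (_∸ p′) (+-suc d₀ p′)) (m+n∸n≡m (suc d₀) p′)))

  coverings-disjoint : ∀ {i p k p′ x} → PieceCovering i p x → PieceCovering k p′ x → i + p ∸ 1 < k → ⊥
  coverings-disjoint C C′ i+p-1<k =
    pieces-disjoint C.piece C′.piece (≤-trans C.below (≤-trans (∸-monoˡ-≤ 1 i+p-1<k) C′.from-i))
                    C.contains C′.contains
    where
    module C = PieceCovering C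
    module C′ = PieceCovering C′

lemma10 : {A : Set} (_<ₐ_ : A → A → Set) → IsStrictTotalOrder _≡_ _<ₐ_ →
    (s : List A) (R : List (L.Run _<ₐ_)) → L.IsLyndonFactorization _<ₐ_ s R →
    (d p i d' p' k : ℕ) →
    L.PGroup _<ₐ_ s R d p i → L.PGroup _<ₐ_ s R d' p' k →
    (i + p ∸ 1 < k ⊎ k + p' ∸ 1 < i) →
    (J J' : L.Interval _<ₐ_) →
    L.Assoc _<ₐ_ s R d p i J → L.Assoc _<ₐ_ s R d' p' k J' →
    ¬ L.Overlap _<ₐ_ J J'
lemma10 _<ₐ_ sto s R LF d p i d′ p′ k G G′ separated (_ , _) (_ , _) A A′ (x , x∈J , x∈J′) =
  [ coverings-disjoint C C′ , coverings-disjoint C′ C ] separated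
  where
  open Factorization sto s R LF
  C = group-covering G A x∈J
  C′ = group-covering G′ A′ x∈J′
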